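{- Let $T$ be a commutative monad on a category $\mathcal{A}$ with finite products, and assume $\mathrm{Alg}(T)$ is symmetric monoidal $(\otimes,I)$ with $I=T(1)$ such that the free functor $F$ is strong monoidal via natural monoidal isomorphisms $\xi\colon T(X)\otimes T(Y)\to T(X\times Y)$, and with universal bi-homomorphisms $\otimes\colon X_1\times X_2\to X_1\otimes X_2$ (underlying maps). For each $\overline{T}$-coalgebra $b$ on an algebra $a\colon T(X)\to X$, the comonoid maps $u_b=T(!)\circ b$ and $d_b=(a\otimes a)\circ\xi^{ -1}\circ T(\Delta)\circ b$ are homomorphisms of $\overline{T}$-coalgebras, where $T(1)$ carries the coalgebra $T(\eta_1)$ and a tensor $X_1\otimes X_2$ of coalgebras $b_1,b_2$ carries the coalgebra $T(\otimes)\circ\xi\circ(b_1\otimes b_2)$. Consequently the category $\mathrm{CoAlg}(\overline{T})$ has finite products (given by $T(\eta_1)$ on $T(1)$ and by this tensor coalgebra), and the functor $\mathcal{A}\to\mathrm{CoAlg}(\overline{T})$ sending $X$ to the coalgebra $T(\eta_X)$ on the free algebra $\mu_X$ preserves finite products.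
   Context: $\mathrm{Alg}(T)$ is the Eilenberg–Moore category of $T=(T,\eta,\mu)$; the induced comonad $\overline{T}$ on $\mathrm{Alg}(T)$ sends $a\colon TX\to X$ to $\mu_X\colon T^2X\to TX$, with counit $a$ and comultiplication $T(\eta_X)$. A $\overline{T}$-coalgebra on $a$ is a map $b\colon X\to TX$ in $\mathcal{A}$ with $b\circ a=\mu_X\circ T(b)$, $a\circ b=\mathrm{id}_X$ and $T(\eta_X)\circ b=T(b)\circ b$; $\mathrm{CoAlg}(\overline{T})$ has as morphisms algebra homomorphisms $f$ with $b_2\circ f=T(f)\circ b_1$. $\Delta$ denotes the diagonal $X\to X\times X$ and $!\colon X\to 1$. -}

module Defs where

open import Level using (Level; _⊔_; suc)
open import Relation.Binary.PropositionalEquality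
  using (_≡_; refl; sym; trans; cong; module ≡-Reasoning)
open import Data.Product using (Σ; _,_; proj₁; proj₂; Σ-syntax) renaming (_×_ to _∧_)

record Category (o ℓ : Level) : Set (suc (o ⊔ ℓ)) where
  infixr 9 _∘_
  field
    Obj       : Set o
    Hom       : Obj → Obj → Set ℓ
    id        : ∀ {A} → Hom A A
    _∘_       : ∀ {A B C} → Hom B C → Hom A B → Hom A C
    identityˡ : ∀ {A B} {f : Hom A B} → id ∘ f ≡ f
    identityʳ : ∀ {A B} {f : Hom A B} → f ∘ id ≡ f
    assoc     : ∀ {A B C D} {f : Hom A B} {g : Hom B C} {h : Hom C D} →
                (h ∘ g) ∘ f ≡ h ∘ (g ∘ f)

module _ {o ℓ} (𝒜 : Category o ℓ) where
  open Category 𝒜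

  record FiniteProducts : Set (o ⊔ ℓ) where
    infixr 7 _×_
    field
      𝟙         : Obj
      !         : ∀ {X} → Hom X 𝟙
      !-unique  : ∀ {X} (f : Hom X 𝟙) → f ≡ !
      _×_       : Obj → Obj → Obj
      π₁        : ∀ {X Y} → Hom (X × Y) X
      π₂        : ∀ {X Y} → Hom (X × Y) Y
      ⟨_,_⟩     : ∀ {Z X Y} → Hom Z X → Hom Z Y → Hom Z (X × Y)
      π₁∘⟨⟩     : ∀ {Z X Y} {f : Hom Z X} {g : Hom Z Y} → π₁ ∘ ⟨ f , g ⟩ ≡ f
      π₂∘⟨⟩     : ∀ {Z X Y} {f : Hom Z X} {g : Hom Z Y} → π₂ ∘ ⟨ f , g ⟩ ≡ g
      ⟨⟩-unique : ∀ {Z X Y} {f : Hom Z X} {g : Hom Z Y} (h : Hom Z (X × Y)) →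
                  π₁ ∘ h ≡ f → π₂ ∘ h ≡ g → h ≡ ⟨ f , g ⟩

    infixr 8 _⁂_
    _⁂_ : ∀ {A B C D} → Hom A B → Hom C D → Hom (A × C) (B × D)
    f ⁂ g = ⟨ f ∘ π₁ , g ∘ π₂ ⟩

    Δ : ∀ {X} → Hom X (X × X)
    Δ = ⟨ id , id ⟩

    swap : ∀ {X Y} → Hom (X × Y) (Y × X)
    swap = ⟨ π₂ , π₁ ⟩

    assocˣ : ∀ {X Y Z} → Hom ((X × Y) × Z) (X × (Y × Z))
    assocˣ = ⟨ π₁ ∘ π₁ , ⟨ π₂ ∘ π₁ , π₂ ⟩ ⟩

  record Monad : Set (o ⊔ ℓ) where
    field
      T           : Obj → Obj
      T₁          : ∀ {X Y} → Hom X Y → Hom (T X) (T Y)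
      T-id        : ∀ {X} → T₁ (id {X}) ≡ id
      T-∘         : ∀ {X Y Z} {f : Hom X Y} {g : Hom Y Z} → T₁ (g ∘ f) ≡ T₁ g ∘ T₁ f
      η           : ∀ X → Hom X (T X)
      μ           : ∀ X → Hom (T (T X)) (T X)
      η-natural   : ∀ {X Y} (f : Hom X Y) → T₁ f ∘ η X ≡ η Y ∘ f
      μ-natural   : ∀ {X Y} (f : Hom X Y) → T₁ f ∘ μ X ≡ μ Y ∘ T₁ (T₁ f)
      μ-assoc     : ∀ {X} → μ X ∘ T₁ (μ X) ≡ μ X ∘ μ (T X)
      μ-η-left    : ∀ {X} → μ X ∘ η (T X) ≡ id
      μ-η-right   : ∀ {X} → μ X ∘ T₁ (η X) ≡ id

module _ {o ℓ} {𝒜 : Category o ℓ} (P : FiniteProducts 𝒜) (M : Monad 𝒜) where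
  open Category 𝒜
  open FiniteProducts P
  open Monad M

  record CommutativeStrength : Set (o ⊔ ℓ) where
    field
      st         : ∀ X Y → Hom (X × T Y) (T (X × Y))
      st-natural : ∀ {X X' Y Y'} (f : Hom X X') (g : Hom Y Y') →
                   T₁ (f ⁂ g) ∘ st X Y ≡ st X' Y' ∘ (f ⁂ T₁ g)
      st-unit    : ∀ {Y} → T₁ π₂ ∘ st 𝟙 Y ≡ π₂
      st-assoc   : ∀ {X Y Z} →
                   T₁ assocˣ ∘ st (X × Y) Z ≡ st X (Y × Z) ∘ (id ⁂ st Y Z) ∘ assocˣ
      st-η       : ∀ {X Y} → st X Y ∘ (id ⁂ η Y) ≡ η (X × Y)
      st-μ       : ∀ {X Y} →
                   st X Y ∘ (id ⁂ μ Y) ≡ μ (X × Y) ∘ T₁ (st X Y) ∘ st X (T Y)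

    cst : ∀ X Y → Hom (T X × Y) (T (X × Y))
    cst X Y = T₁ swap ∘ st Y X ∘ swap

    field
      commutative : ∀ {X Y} →
        μ (X × Y) ∘ T₁ (cst X Y) ∘ st (T X) Y ≡ μ (X × Y) ∘ T₁ (st X Y) ∘ cst X (T Y)

module _ {o ℓ} {𝒜 : Category o ℓ} (M : Monad 𝒜) where
  open Category 𝒜
  open Monad M

  record Alg : Set (o ⊔ ℓ) where
    field
      Carrier : Obj
      act     : Hom (T Carrier) Carrier
      act-η   : act ∘ η Carrier ≡ id
      act-μ   : act ∘ T₁ act ≡ act ∘ μ Carrier
  open Alg public

  record AlgHom (A B : Alg) : Set ℓ where
    field
      hom      : Hom (Carrier A) (Carrier B)
      commutes : hom ∘ act A ≡ act B ∘ T₁ hom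
  open AlgHom public

  idᴬ : ∀ {A} → AlgHom A A
  idᴬ {A} = record
    { hom = id
    ; commutes = trans identityˡ (trans (sym identityʳ) (cong (act A ∘_) (sym T-id))) }

  infixr 9 _∘ᴬ_
  _∘ᴬ_ : ∀ {A B C} → AlgHom B C → AlgHom A B → AlgHom A C
  _∘ᴬ_ {A} {B} {C} g f = record { hom = hom g ∘ hom f ; commutes = pf }
    where
    open ≡-Reasoning
    pf : (hom g ∘ hom f) ∘ act A ≡ act C ∘ T₁ (hom g ∘ hom f)
    pf = begin
      (hom g ∘ hom f) ∘ act A      ≡⟨ assoc ⟩
      hom g ∘ (hom f ∘ act A)      ≡⟨ cong (hom g ∘_) (commutes f) ⟩
      hom g ∘ (act B ∘ T₁ (hom f)) ≡⟨ sym assoc ⟩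
      (hom g ∘ act B) ∘ T₁ (hom f) ≡⟨ cong (_∘ T₁ (hom f)) (commutes g) ⟩
      (act C ∘ T₁ (hom g)) ∘ T₁ (hom f) ≡⟨ assoc ⟩
      act C ∘ (T₁ (hom g) ∘ T₁ (hom f)) ≡⟨ cong (act C ∘_) (sym T-∘) ⟩
      act C ∘ T₁ (hom g ∘ hom f)   ∎

  Free : Obj → Alg
  Free X = record { Carrier = T X ; act = μ X ; act-η = μ-η-left ; act-μ = μ-assoc }

  free-hom : ∀ {X Y} → Hom X Y → AlgHom (Free X) (Free Y)
  free-hom f = record { hom = T₁ f ; commutes = μ-natural f }

  act-hom : ∀ A → AlgHom (Free (Carrier A)) A
  act-hom A = record { hom = act A ; commutes = sym (act-μ A) }

  -- b is a coalgebra of the comonad T̄ on the algebra A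
  IsCoalg : (A : Alg) → Hom (Carrier A) (T (Carrier A)) → Set ℓ
  IsCoalg A b =
    (b ∘ act A ≡ μ (Carrier A) ∘ T₁ b)
    ∧ (act A ∘ b ≡ id)
    ∧ (T₁ (η (Carrier A)) ∘ b ≡ T₁ b ∘ b)

  IsCoalgMor : (A : Alg) → Hom (Carrier A) (T (Carrier A)) →
               (B : Alg) → Hom (Carrier B) (T (Carrier B)) →
               Hom (Carrier A) (Carrier B) → Set ℓ
  IsCoalgMor A b B c f = (f ∘ act A ≡ act B ∘ T₁ f) ∧ (c ∘ f ≡ T₁ f ∘ b)

  record CoalgObj : Set (o ⊔ ℓ) where
    field
      alg     : Alg
      coalg   : Hom (Carrier alg) (T (Carrier alg))
      isCoalg : IsCoalg alg coalg
  open CoalgObj public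

  coalg-hom : (Q : CoalgObj) → AlgHom (alg Q) (Free (Carrier (alg Q)))
  coalg-hom Q = record { hom = coalg Q ; commutes = proj₁ (isCoalg Q) }

  CoalgHom : CoalgObj → CoalgObj → Set ℓ
  CoalgHom Q R = Σ (Hom (Carrier (alg Q)) (Carrier (alg R)))
                   (IsCoalgMor (alg Q) (coalg Q) (alg R) (coalg R))

  IsTerminalᶜ : CoalgObj → Set (o ⊔ ℓ)
  IsTerminalᶜ R = ∀ (Q : CoalgObj) →
    Σ (CoalgHom Q R) λ h → ∀ (h' : CoalgHom Q R) → proj₁ h' ≡ proj₁ h

  IsProductᶜ : (R Q₁ Q₂ : CoalgObj) → CoalgHom R Q₁ → CoalgHom R Q₂ → Set (o ⊔ ℓ)
  IsProductᶜ R Q₁ Q₂ p₁ p₂ = ∀ (Q : CoalgObj) (q₁ : CoalgHom Q Q₁) (q₂ : CoalgHom Q Q₂) →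
    Σ (CoalgHom Q R) λ h →
      (proj₁ p₁ ∘ proj₁ h ≡ proj₁ q₁) ∧ (proj₁ p₂ ∘ proj₁ h ≡ proj₁ q₂)
      ∧ (∀ (h' : CoalgHom Q R) → proj₁ p₁ ∘ proj₁ h' ≡ proj₁ q₁ →
           proj₁ p₂ ∘ proj₁ h' ≡ proj₁ q₂ → proj₁ h' ≡ proj₁ h)

  FreeCoalg : Obj → CoalgObj
  FreeCoalg X = record
    { alg = Free X
    ; coalg = T₁ (η X)
    ; isCoalg = μ-natural (η X)
              , μ-η-right
              , trans (sym T-∘) (trans (cong T₁ (sym (η-natural (η X)))) T-∘) }

  FreeCoalg₁ : ∀ {X Y} → Hom X Y → CoalgHom (FreeCoalg X) (FreeCoalg Y)
  FreeCoalg₁ f = T₁ f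
               , μ-natural f
               , trans (sym T-∘) (trans (cong T₁ (sym (η-natural f))) T-∘)

module _ {o ℓ} {𝒜 : Category o ℓ} {P : FiniteProducts 𝒜} {M : Monad 𝒜}
         (S : CommutativeStrength P M) where
  open Category 𝒜
  open FiniteProducts P
  open Monad M
  open CommutativeStrength S

  IsBihom : (A₁ A₂ C : Alg M) → Hom (Carrier A₁ × Carrier A₂) (Carrier C) → Set ℓ
  IsBihom A₁ A₂ C f =
    (f ∘ (id ⁂ act A₂) ≡ act C ∘ T₁ f ∘ st (Carrier A₁) (Carrier A₂))
    ∧ (f ∘ (act A₁ ⁂ id) ≡ act C ∘ T₁ f ∘ cst (Carrier A₁) (Carrier A₂))

  record AlgTensor : Set (o ⊔ ℓ) where
    infixr 7 _⊗₀_ _⊗₁_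
    field
      _⊗₀_ : Alg M → Alg M → Alg M
      _⊗₁_ : ∀ {A B C D} → AlgHom M A B → AlgHom M C D → AlgHom M (A ⊗₀ C) (B ⊗₀ D)
      ⊗-id : ∀ {A B} → hom (idᴬ M {A} ⊗₁ idᴬ M {B}) ≡ id
      ⊗-∘  : ∀ {A B C A' B' C'} (f : AlgHom M A B) (g : AlgHom M B C)
               (f' : AlgHom M A' B') (g' : AlgHom M B' C') →
             hom (_∘ᴬ_ M g f ⊗₁ _∘ᴬ_ M g' f') ≡ hom (g ⊗₁ g') ∘ hom (f ⊗₁ f')

    I : Alg M
    I = Free M 𝟙

    field
      α      : ∀ A B C → AlgHom M ((A ⊗₀ B) ⊗₀ C) (A ⊗₀ (B ⊗₀ C))
      α⁻¹    : ∀ A B C → AlgHom M (A ⊗₀ (B ⊗₀ C)) ((A ⊗₀ B) ⊗₀ C)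
      α-iso₁ : ∀ {A B C} → hom (α⁻¹ A B C) ∘ hom (α A B C) ≡ id
      α-iso₂ : ∀ {A B C} → hom (α A B C) ∘ hom (α⁻¹ A B C) ≡ id
      λᵘ     : ∀ A → AlgHom M (I ⊗₀ A) A
      λᵘ⁻¹   : ∀ A → AlgHom M A (I ⊗₀ A)
      λ-iso₁ : ∀ {A} → hom (λᵘ⁻¹ A) ∘ hom (λᵘ A) ≡ id
      λ-iso₂ : ∀ {A} → hom (λᵘ A) ∘ hom (λᵘ⁻¹ A) ≡ id
      ρᵘ     : ∀ A → AlgHom M (A ⊗₀ I) A
      ρᵘ⁻¹   : ∀ A → AlgHom M A (A ⊗₀ I)
      ρ-iso₁ : ∀ {A} → hom (ρᵘ⁻¹ A) ∘ hom (ρᵘ A) ≡ id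
      ρ-iso₂ : ∀ {A} → hom (ρᵘ A) ∘ hom (ρᵘ⁻¹ A) ≡ id
      σ      : ∀ A B → AlgHom M (A ⊗₀ B) (B ⊗₀ A)
      σ-inv  : ∀ {A B} → hom (σ B A) ∘ hom (σ A B) ≡ id
      α-natural : ∀ {A A' B B' C C'} (f : AlgHom M A A') (g : AlgHom M B B') (h : AlgHom M C C') →
                  hom (α A' B' C') ∘ hom ((f ⊗₁ g) ⊗₁ h) ≡ hom (f ⊗₁ (g ⊗₁ h)) ∘ hom (α A B C)
      λ-natural : ∀ {A A'} (f : AlgHom M A A') →
                  hom (λᵘ A') ∘ hom (idᴬ M {I} ⊗₁ f) ≡ hom f ∘ hom (λᵘ A)
      ρ-natural : ∀ {A A'} (f : AlgHom M A A') →
                  hom (ρᵘ A') ∘ hom (f ⊗₁ idᴬ M {I}) ≡ hom f ∘ hom (ρᵘ A)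
      σ-natural : ∀ {A A' B B'} (f : AlgHom M A A') (g : AlgHom M B B') →
                  hom (σ A' B') ∘ hom (f ⊗₁ g) ≡ hom (g ⊗₁ f) ∘ hom (σ A B)
      pentagon  : ∀ {A B C D} →
                  hom (α A B (C ⊗₀ D)) ∘ hom (α (A ⊗₀ B) C D)
                  ≡ hom (idᴬ M {A} ⊗₁ α B C D) ∘ hom (α A (B ⊗₀ C) D) ∘ hom (α A B C ⊗₁ idᴬ M {D})
      triangle  : ∀ {A B} →
                  hom (idᴬ M {A} ⊗₁ λᵘ B) ∘ hom (α A I B) ≡ hom (ρᵘ A ⊗₁ idᴬ M {B})
      hexagon   : ∀ {A B C} →
                  hom (α B C A) ∘ hom (σ A (B ⊗₀ C)) ∘ hom (α A B C)
                  ≡ hom (idᴬ M {B} ⊗₁ σ A C) ∘ hom (α B A C) ∘ hom (σ A B ⊗₁ idᴬ M {C})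

      ⊠         : ∀ A B → Hom (Carrier A × Carrier B) (Carrier (A ⊗₀ B))
      ⊠-bihom   : ∀ A B → IsBihom A B (A ⊗₀ B) (⊠ A B)
      ⊠-exists  : ∀ {A B C} (f : Hom (Carrier A × Carrier B) (Carrier C)) → IsBihom A B C f →
                  Σ (AlgHom M (A ⊗₀ B) C) λ h → hom h ∘ ⊠ A B ≡ f
      ⊠-unique  : ∀ {A B C} (h h' : AlgHom M (A ⊗₀ B) C) →
                  hom h ∘ ⊠ A B ≡ hom h' ∘ ⊠ A B → hom h ≡ hom h'
      ⊠-natural : ∀ {A A' B B'} (f : AlgHom M A A') (g : AlgHom M B B') →
                  hom (f ⊗₁ g) ∘ ⊠ A B ≡ ⊠ A' B' ∘ (hom f ⁂ hom g)

      -- F strong monoidal: natural monoidal isomorphisms ξ : T X ⊗ T Y → T(X × Y)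
      -- (the unit comparison I → F(1) is the identity, since I = T(1))
      ξ         : ∀ X Y → AlgHom M (Free M X ⊗₀ Free M Y) (Free M (X × Y))
      ξ⁻¹       : ∀ X Y → AlgHom M (Free M (X × Y)) (Free M X ⊗₀ Free M Y)
      ξ-iso₁    : ∀ {X Y} → hom (ξ⁻¹ X Y) ∘ hom (ξ X Y) ≡ id
      ξ-iso₂    : ∀ {X Y} → hom (ξ X Y) ∘ hom (ξ⁻¹ X Y) ≡ id
      ξ-natural : ∀ {X X' Y Y'} (f : Hom X X') (g : Hom Y Y') →
                  T₁ (f ⁂ g) ∘ hom (ξ X Y) ≡ hom (ξ X' Y') ∘ hom (free-hom M f ⊗₁ free-hom M g)
      ξ-assoc   : ∀ {X Y Z} →
                  T₁ assocˣ ∘ hom (ξ (X × Y) Z) ∘ hom (ξ X Y ⊗₁ idᴬ M {Free M Z})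
                  ≡ hom (ξ X (Y × Z)) ∘ hom (idᴬ M {Free M X} ⊗₁ ξ Y Z)
                    ∘ hom (α (Free M X) (Free M Y) (Free M Z))
      ξ-unitˡ   : ∀ {Y} → T₁ π₂ ∘ hom (ξ 𝟙 Y) ≡ hom (λᵘ (Free M Y))
      ξ-unitʳ   : ∀ {X} → T₁ π₁ ∘ hom (ξ X 𝟙) ≡ hom (ρᵘ (Free M X))
      ξ-⊠       : ∀ {X Y} → hom (ξ X Y) ∘ ⊠ (Free M X) (Free M Y) ∘ (η X ⁂ η Y) ≡ η (X × Y)

  module _ (𝕋 : AlgTensor) where
    open AlgTensor 𝕋

    u : (Q : CoalgObj M) → Hom (Carrier (alg Q)) (T 𝟙)
    u Q = T₁ ! ∘ coalg Q

    d : (Q : CoalgObj M) → Hom (Carrier (alg Q)) (Carrier (alg Q ⊗₀ alg Q))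
    d Q = hom (act-hom M (alg Q) ⊗₁ act-hom M (alg Q))
          ∘ hom (ξ⁻¹ (Carrier (alg Q)) (Carrier (alg Q))) ∘ T₁ Δ ∘ coalg Q

    tensorCoalg : (Q₁ Q₂ : CoalgObj M) →
      Hom (Carrier (alg Q₁ ⊗₀ alg Q₂)) (T (Carrier (alg Q₁ ⊗₀ alg Q₂)))
    tensorCoalg Q₁ Q₂ = T₁ (⊠ (alg Q₁) (alg Q₂))
                        ∘ hom (ξ (Carrier (alg Q₁)) (Carrier (alg Q₂)))
                        ∘ hom (coalg-hom M Q₁ ⊗₁ coalg-hom M Q₂)

    tensorCoalgObj : (Q₁ Q₂ : CoalgObj M) → IsCoalg M (alg Q₁ ⊗₀ alg Q₂) (tensorCoalg Q₁ Q₂) →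
                     CoalgObj M
    tensorCoalgObj Q₁ Q₂ c = record { alg = alg Q₁ ⊗₀ alg Q₂ ; coalg = tensorCoalg Q₁ Q₂ ; isCoalg = c }

module Submission where

-- Proposition 6.6.  Fix T̄-coalgebras b₁ , b₂ on algebras a₁ , a₂ with carriers X₁ , X₂, and put
--   B = b₁ ⁂ b₂ ,   φ = ξ ∘ ⊠ : TX × TY → T(X × Y) ,   Ψ = ξ ∘ (b₁ ⊗ b₂) : X₁ ⊗ X₂ → T(X₁ × X₂),
-- so that the tensor coalgebra is t = T(⊠) ∘ Ψ and Ψ ∘ ⊠ = φ ∘ B.  The proof rests on:
--   * algebra maps out of A₁ ⊗ A₂ , F X and F X ⊗ F Y are determined by their composites with
--     ⊠ , η and ⊠ ∘ (η ⁂ η) respectively;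
--   * the coalgebra law T(η) ∘ b = T(b) ∘ b makes Ψ forget B:  T(g ∘ B) ∘ Ψ = T(g ∘ (η ⁂ η)) ∘ Ψ
--     for every g ("collapse").
-- From these, t is a coalgebra, the maps pᵢ = aᵢ ∘ T(πᵢ) ∘ Ψ are coalgebra morphisms, and
-- Ψ = T⟨p₁ , p₂⟩ ∘ t, so that a coalgebra morphism into X₁ ⊗ X₂ is determined by its two
-- components.  The comonoid maps u_b = T(!) ∘ b and d_b are coalgebra morphisms; pairing
-- q₁ , q₂ is (q₁ ⊗ q₂) ∘ d_b.  T(η₁) on T(1) is terminal because T(!) ∘ T(η₁) = id, and the
-- free coalgebra on X × Y is the tensor of the free ones, transported along the isomorphism ξ.

open import Defs
open import Level using (Level)
open import Data.Product using (Σ; Σ-syntax; _,_; proj₁; proj₂) renaming (_×_ to _∧_)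
open import Relation.Binary.PropositionalEquality
  using (_≡_; sym; trans; cong; cong₂; module ≡-Reasoning)

module CategoryReasoning {o ℓ} (𝒜 : Category o ℓ) where
  open Category 𝒜

  ∘-congˡ : ∀ {A B C} {f f' : Hom B C} {g : Hom A B} → f ≡ f' → f ∘ g ≡ f' ∘ g
  ∘-congˡ {g = g} = cong (_∘ g)

  ∘-congʳ : ∀ {A B C} {f : Hom B C} {g g' : Hom A B} → g ≡ g' → f ∘ g ≡ f ∘ g'
  ∘-congʳ {f = f} = cong (f ∘_)

  pullˡ : ∀ {A B C D} {a : Hom C D} {b : Hom B C} {c : Hom B D} {f : Hom A B} →
          a ∘ b ≡ c → a ∘ b ∘ f ≡ c ∘ f
  pullˡ eq = trans (sym assoc) (∘-congˡ eq)

  pullʳ : ∀ {A B C D} {a : Hom B C} {b : Hom A B} {c : Hom A C} {f : Hom C D} →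
          a ∘ b ≡ c → (f ∘ a) ∘ b ≡ f ∘ c
  pullʳ eq = trans assoc (∘-congʳ eq)

  assoc² : ∀ {A B C D E} {f : Hom A B} {g : Hom B C} {h : Hom C D} {k : Hom D E} →
           (k ∘ h ∘ g) ∘ f ≡ k ∘ h ∘ g ∘ f
  assoc² = trans assoc (∘-congʳ assoc)

module ProductLemmas {o ℓ} {𝒜 : Category o ℓ} (P : FiniteProducts 𝒜) where
  open Category 𝒜
  open FiniteProducts P
  open CategoryReasoning 𝒜

  ⟨⟩∘ : ∀ {W Z X Y} {f : Hom Z X} {g : Hom Z Y} {h : Hom W Z} →
        ⟨ f , g ⟩ ∘ h ≡ ⟨ f ∘ h , g ∘ h ⟩
  ⟨⟩∘ = ⟨⟩-unique _ (pullˡ π₁∘⟨⟩) (pullˡ π₂∘⟨⟩)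

  ⁂∘⟨⟩ : ∀ {W X Y X' Y'} {f : Hom X X'} {g : Hom Y Y'} {h : Hom W X} {k : Hom W Y} →
         (f ⁂ g) ∘ ⟨ h , k ⟩ ≡ ⟨ f ∘ h , g ∘ k ⟩
  ⁂∘⟨⟩ = trans ⟨⟩∘ (cong₂ ⟨_,_⟩ (pullʳ π₁∘⟨⟩) (pullʳ π₂∘⟨⟩))

  ⁂∘⁂ : ∀ {X Y X' Y' X'' Y''} {f : Hom X' X''} {g : Hom Y' Y''} {h : Hom X X'} {k : Hom Y Y'} →
        (f ⁂ g) ∘ (h ⁂ k) ≡ (f ∘ h) ⁂ (g ∘ k)
  ⁂∘⁂ = trans ⁂∘⟨⟩ (cong₂ ⟨_,_⟩ (sym assoc) (sym assoc))

  ⁂-cong : ∀ {X Y X' Y'} {f f' : Hom X X'} {g g' : Hom Y Y'} → f ≡ f' → g ≡ g' → f ⁂ g ≡ f' ⁂ g'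
  ⁂-cong p q = cong₂ ⟨_,_⟩ (∘-congˡ p) (∘-congˡ q)

  ⟨π₁,π₂⟩ : ∀ {X Y} → ⟨ π₁ , π₂ ⟩ ≡ id {X × Y}
  ⟨π₁,π₂⟩ = sym (⟨⟩-unique id identityʳ identityʳ)

  ⁂-id : ∀ {X Y} → id {X} ⁂ id {Y} ≡ id
  ⁂-id = trans (cong₂ ⟨_,_⟩ identityˡ identityˡ) ⟨π₁,π₂⟩

  ⁂∘Δ : ∀ {X Y Z} {f : Hom X Y} {g : Hom X Z} → (f ⁂ g) ∘ Δ ≡ ⟨ f , g ⟩
  ⁂∘Δ = trans ⁂∘⟨⟩ (cong₂ ⟨_,_⟩ identityʳ identityʳ)

  Δ-natural : ∀ {X Y} {f : Hom X Y} → Δ ∘ f ≡ (f ⁂ f) ∘ Δ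
  Δ-natural = trans ⟨⟩∘ (trans (cong₂ ⟨_,_⟩ identityˡ identityˡ) (sym ⁂∘Δ))

  !-unique₂ : ∀ {X} (f g : Hom X 𝟙) → f ≡ g
  !-unique₂ f g = trans (!-unique f) (sym (!-unique g))

module CoalgebraLemmas {o ℓ} {𝒜 : Category o ℓ} {P : FiniteProducts 𝒜} (M : Monad 𝒜) where
  open Category 𝒜
  open FiniteProducts P
  open Monad M
  open CategoryReasoning 𝒜
  open ProductLemmas P
  open ≡-Reasoning

  μ∘Tη : ∀ {X Y} (f : Hom X Y) → μ Y ∘ T₁ (η Y ∘ f) ≡ T₁ f
  μ∘Tη f = trans (∘-congʳ T-∘) (trans (pullˡ μ-η-right) identityˡ)

  free-ext : ∀ {X} {C : Alg M} (f g : AlgHom M (Free M X) C) →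
             hom f ∘ η X ≡ hom g ∘ η X → hom f ≡ hom g
  free-ext {X} {C} f g eq = trans (expand f) (trans (cong (λ z → act C ∘ T₁ z) eq) (sym (expand g)))
    where
    expand : (h : AlgHom M (Free M X) C) → hom h ≡ act C ∘ T₁ (hom h ∘ η X)
    expand h = begin
      hom h                            ≡⟨ sym identityʳ ⟩
      hom h ∘ id                       ≡⟨ ∘-congʳ (sym μ-η-right) ⟩
      hom h ∘ μ X ∘ T₁ (η X)           ≡⟨ pullˡ (commutes h) ⟩
      (act C ∘ T₁ (hom h)) ∘ T₁ (η X)  ≡⟨ pullʳ (sym T-∘) ⟩
      act C ∘ T₁ (hom h ∘ η X)         ∎

  module _ (Q : CoalgObj M) where
    private
      X : Obj
      X = Carrier (alg Q)

    counit : act (alg Q) ∘ coalg Q ≡ id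
    counit = proj₁ (proj₂ (isCoalg Q))

    coassoc : T₁ (η X) ∘ coalg Q ≡ T₁ (coalg Q) ∘ coalg Q
    coassoc = proj₂ (proj₂ (isCoalg Q))

    absorb : ∀ {Z} (h : Hom (T X) Z) → T₁ (h ∘ coalg Q) ∘ coalg Q ≡ T₁ (h ∘ η X) ∘ coalg Q
    absorb h = begin
      T₁ (h ∘ coalg Q) ∘ coalg Q         ≡⟨ trans (∘-congˡ T-∘) assoc ⟩
      T₁ h ∘ T₁ (coalg Q) ∘ coalg Q      ≡⟨ ∘-congʳ (sym coassoc) ⟩
      T₁ h ∘ T₁ (η X) ∘ coalg Q          ≡⟨ pullˡ (sym T-∘) ⟩
      T₁ (h ∘ η X) ∘ coalg Q             ∎

    coalg-mor : CoalgHom M Q (FreeCoalg M X)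
    coalg-mor = coalg Q , proj₁ (isCoalg Q) , coassoc

  algHom : ∀ {Q R} → CoalgHom M Q R → AlgHom M (alg Q) (alg R)
  algHom f = record { hom = proj₁ f ; commutes = proj₁ (proj₂ f) }

  retract : ∀ {Q R} (f : CoalgHom M Q R) → act (alg R) ∘ T₁ (proj₁ f) ∘ coalg Q ≡ proj₁ f
  retract {Q} {R} f = begin
    act (alg R) ∘ T₁ (proj₁ f) ∘ coalg Q  ≡⟨ pullˡ (sym (proj₁ (proj₂ f))) ⟩
    (proj₁ f ∘ act (alg Q)) ∘ coalg Q     ≡⟨ pullʳ (counit Q) ⟩
    proj₁ f ∘ id                    ≡⟨ identityʳ ⟩
    proj₁ f                         ∎

  -- composition in CoAlg(T̄); the objects are explicit since they cannot be inferred from maps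
  compose : ∀ Q₁ Q₂ Q₃ → CoalgHom M Q₂ Q₃ → CoalgHom M Q₁ Q₂ → CoalgHom M Q₁ Q₃
  compose Q₁ Q₂ Q₃ g f =
    proj₁ g ∘ proj₁ f , commutes (_∘ᴬ_ M (algHom {Q₂} {Q₃} g) (algHom {Q₁} {Q₂} f)) , comm
    where
    comm : coalg Q₃ ∘ proj₁ g ∘ proj₁ f ≡ T₁ (proj₁ g ∘ proj₁ f) ∘ coalg Q₁
    comm = begin
      coalg Q₃ ∘ proj₁ g ∘ proj₁ f          ≡⟨ pullˡ (proj₂ (proj₂ g)) ⟩
      (T₁ (proj₁ g) ∘ coalg Q₂) ∘ proj₁ f   ≡⟨ pullʳ (proj₂ (proj₂ f)) ⟩
      T₁ (proj₁ g) ∘ T₁ (proj₁ f) ∘ coalg Q₁ ≡⟨ pullˡ (sym T-∘) ⟩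
      T₁ (proj₁ g ∘ proj₁ f) ∘ coalg Q₁     ∎

  discard : (Q : CoalgObj M) → CoalgHom M Q (FreeCoalg M 𝟙)
  discard Q = compose Q (FreeCoalg M (Carrier (alg Q))) (FreeCoalg M 𝟙) (FreeCoalg₁ M !) (coalg-mor Q)

  free-terminal : IsTerminalᶜ M (FreeCoalg M 𝟙)
  free-terminal Q = discard Q , unique
    where
    unique : (f : CoalgHom M Q (FreeCoalg M 𝟙)) → proj₁ f ≡ T₁ ! ∘ coalg Q
    unique (f , _ , f-coalg) = begin
      f                       ≡⟨ sym identityˡ ⟩
      id ∘ f                  ≡⟨ ∘-congˡ (trans (sym T-id) (cong T₁ (!-unique₂ id (! ∘ η 𝟙)))) ⟩
      T₁ (! ∘ η 𝟙) ∘ f        ≡⟨ trans (∘-congˡ T-∘) assoc ⟩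
      T₁ ! ∘ T₁ (η 𝟙) ∘ f     ≡⟨ ∘-congʳ f-coalg ⟩
      T₁ ! ∘ T₁ f ∘ coalg Q   ≡⟨ pullˡ (sym T-∘) ⟩
      T₁ (! ∘ f) ∘ coalg Q    ≡⟨ ∘-congˡ (cong T₁ (!-unique₂ (! ∘ f) !)) ⟩
      T₁ ! ∘ coalg Q          ∎

  transport-product :
    ∀ {R R' Q₁ Q₂} {p₁ : CoalgHom M R Q₁} {p₂ : CoalgHom M R Q₂}
      {p₁' : CoalgHom M R' Q₁} {p₂' : CoalgHom M R' Q₂}
      (i : CoalgHom M R R') (j : CoalgHom M R' R) → proj₁ i ∘ proj₁ j ≡ id →
      proj₁ p₁' ∘ proj₁ i ≡ proj₁ p₁ → proj₁ p₂' ∘ proj₁ i ≡ proj₁ p₂ →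
      IsProductᶜ M R Q₁ Q₂ p₁ p₂ → IsProductᶜ M R' Q₁ Q₂ p₁' p₂'
  transport-product {R} {R'} {p₁ = p₁} {p₂} {p₁'} {p₂'} i j ij e₁ e₂ product Q q₁ q₂
    with product Q q₁ q₂
  ... | h , h₁ , h₂ , h-unique =
    compose Q R R' i h , trans (pullˡ e₁) h₁ , trans (pullˡ e₂) h₂ , unique
    where
    back : ∀ {Z} {p : Hom (Carrier (alg R)) Z} {p' : Hom (Carrier (alg R')) Z}
             (f : Hom (Carrier (alg Q)) (Carrier (alg R'))) →
           p' ∘ proj₁ i ≡ p → p ∘ proj₁ j ∘ f ≡ p' ∘ f
    back {p = p} {p'} f e = begin
      p ∘ proj₁ j ∘ f                ≡⟨ ∘-congˡ (sym e) ⟩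
      (p' ∘ proj₁ i) ∘ proj₁ j ∘ f   ≡⟨ pullʳ (pullˡ ij) ⟩
      p' ∘ id ∘ f                    ≡⟨ ∘-congʳ identityˡ ⟩
      p' ∘ f                         ∎

    unique : (f : CoalgHom M Q R') → proj₁ p₁' ∘ proj₁ f ≡ proj₁ q₁ →
             proj₁ p₂' ∘ proj₁ f ≡ proj₁ q₂ → proj₁ f ≡ proj₁ i ∘ proj₁ h
    unique f f₁ f₂ = begin
      proj₁ f                         ≡⟨ sym (trans (pullˡ ij) identityˡ) ⟩
      proj₁ i ∘ proj₁ j ∘ proj₁ f     ≡⟨ ∘-congʳ (h-unique (compose Q R' R j f)
                                            (trans (back (proj₁ f) e₁) f₁) (trans (back (proj₁ f) e₂) f₂)) ⟩
      proj₁ i ∘ proj₁ h               ∎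

module TensorCoalgebras {o ℓ} {𝒜 : Category o ℓ} {P : FiniteProducts 𝒜} {M : Monad 𝒜}
  (S : CommutativeStrength P M) (𝕋 : AlgTensor S) where
  open Category 𝒜
  open FiniteProducts P
  open Monad M
  open AlgTensor 𝕋
  open CategoryReasoning 𝒜
  open ProductLemmas P
  open CoalgebraLemmas {P = P} M
  open ≡-Reasoning

  F : Obj → Alg M
  F = Free M

  infixr 9 _∘ₐ_
  _∘ₐ_ : ∀ {A B C} → AlgHom M B C → AlgHom M A B → AlgHom M A C
  _∘ₐ_ = _∘ᴬ_ M

  φ : ∀ X Y → Hom (T X × T Y) (T (X × Y))
  φ X Y = hom (ξ X Y) ∘ ⊠ (F X) (F Y)

  φ-η : ∀ {X Y} → φ X Y ∘ (η X ⁂ η Y) ≡ η (X × Y)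
  φ-η = trans assoc ξ-⊠

  φ-natural : ∀ {X Y X' Y'} {f : Hom X X'} {g : Hom Y Y'} →
              φ X' Y' ∘ (T₁ f ⁂ T₁ g) ≡ T₁ (f ⁂ g) ∘ φ X Y
  φ-natural {f = f} {g} = begin
    (hom (ξ _ _) ∘ ⊠ _ _) ∘ (T₁ f ⁂ T₁ g)
      ≡⟨ pullʳ (sym (⊠-natural (free-hom M f) (free-hom M g))) ⟩
    hom (ξ _ _) ∘ hom (free-hom M f ⊗₁ free-hom M g) ∘ ⊠ _ _ ≡⟨ pullˡ (sym (ξ-natural f g)) ⟩
    (T₁ (f ⁂ g) ∘ hom (ξ _ _)) ∘ ⊠ _ _               ≡⟨ assoc ⟩
    T₁ (f ⁂ g) ∘ φ _ _                                ∎

  ξ⁻¹-η : ∀ {X Y} → hom (ξ⁻¹ X Y) ∘ η (X × Y) ≡ ⊠ (F X) (F Y) ∘ (η X ⁂ η Y)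
  ξ⁻¹-η = trans (∘-congʳ (sym ξ-⊠)) (trans (pullˡ ξ-iso₁) identityˡ)

  -- an algebra map out of F X ⊗ F Y is determined by its composite with ⊠ ∘ (η ⁂ η),
  -- since precomposing with ξ⁻¹ gives a map out of the free algebra F(X × Y)
  free-tensor-ext : ∀ {X Y} {C : Alg M} (h h' : AlgHom M (F X ⊗₀ F Y) C) →
                    hom h ∘ ⊠ (F X) (F Y) ∘ (η X ⁂ η Y) ≡ hom h' ∘ ⊠ (F X) (F Y) ∘ (η X ⁂ η Y) →
                    hom h ≡ hom h'
  free-tensor-ext {X} {Y} {C} h h' eq = begin
    hom h                                    ≡⟨ through-ξ⁻¹ h ⟩
    (hom h ∘ hom (ξ⁻¹ X Y)) ∘ hom (ξ X Y)    ≡⟨ ∘-congˡ on-free ⟩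
    (hom h' ∘ hom (ξ⁻¹ X Y)) ∘ hom (ξ X Y)   ≡⟨ sym (through-ξ⁻¹ h') ⟩
    hom h'                                   ∎
    where
    through-ξ⁻¹ : (k : AlgHom M (F X ⊗₀ F Y) C) → hom k ≡ (hom k ∘ hom (ξ⁻¹ X Y)) ∘ hom (ξ X Y)
    through-ξ⁻¹ k = sym (trans (pullʳ ξ-iso₁) identityʳ)
    on-free : hom h ∘ hom (ξ⁻¹ X Y) ≡ hom h' ∘ hom (ξ⁻¹ X Y)
    on-free = free-ext (h ∘ₐ ξ⁻¹ X Y) (h' ∘ₐ ξ⁻¹ X Y)
      (trans (pullʳ ξ⁻¹-η) (trans eq (sym (pullʳ ξ⁻¹-η))))

  actions-on-units : ∀ (A₁ A₂ : Alg M) →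
    hom (act-hom M A₁ ⊗₁ act-hom M A₂) ∘ ⊠ (F (Carrier A₁)) (F (Carrier A₂)) ∘ (η _ ⁂ η _) ≡ ⊠ A₁ A₂
  actions-on-units A₁ A₂ = begin
    hom (act-hom M A₁ ⊗₁ act-hom M A₂) ∘ ⊠ _ _ ∘ (η _ ⁂ η _)
      ≡⟨ pullˡ (⊠-natural (act-hom M A₁) (act-hom M A₂)) ⟩
    (⊠ A₁ A₂ ∘ (act A₁ ⁂ act A₂)) ∘ (η _ ⁂ η _)
      ≡⟨ pullʳ (trans ⁂∘⁂ (trans (⁂-cong (act-η A₁) (act-η A₂)) ⁂-id)) ⟩
    ⊠ A₁ A₂ ∘ id                                              ≡⟨ identityʳ ⟩
    ⊠ A₁ A₂                                                   ∎

  act-T⊠-ξ : ∀ (A₁ A₂ : Alg M) →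
    act (A₁ ⊗₀ A₂) ∘ T₁ (⊠ A₁ A₂) ∘ hom (ξ (Carrier A₁) (Carrier A₂))
    ≡ hom (act-hom M A₁ ⊗₁ act-hom M A₂)
  act-T⊠-ξ A₁ A₂ =
    free-tensor-ext (act-hom M (A₁ ⊗₀ A₂) ∘ₐ free-hom M (⊠ A₁ A₂) ∘ₐ ξ _ _)
                    (act-hom M A₁ ⊗₁ act-hom M A₂) (begin
      (act (A₁ ⊗₀ A₂) ∘ T₁ (⊠ A₁ A₂) ∘ hom (ξ _ _)) ∘ ⊠ _ _ ∘ (η _ ⁂ η _) ≡⟨ assoc² ⟩
      act (A₁ ⊗₀ A₂) ∘ T₁ (⊠ A₁ A₂) ∘ hom (ξ _ _) ∘ ⊠ _ _ ∘ (η _ ⁂ η _)   ≡⟨ ∘-congʳ (∘-congʳ ξ-⊠) ⟩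
      act (A₁ ⊗₀ A₂) ∘ T₁ (⊠ A₁ A₂) ∘ η _                                 ≡⟨ ∘-congʳ (η-natural _) ⟩
      act (A₁ ⊗₀ A₂) ∘ η _ ∘ ⊠ A₁ A₂                                      ≡⟨ pullˡ (act-η (A₁ ⊗₀ A₂)) ⟩
      id ∘ ⊠ A₁ A₂                                                        ≡⟨ identityˡ ⟩
      ⊠ A₁ A₂                                                             ≡⟨ sym (actions-on-units A₁ A₂) ⟩
      hom (act-hom M A₁ ⊗₁ act-hom M A₂) ∘ ⊠ _ _ ∘ (η _ ⁂ η _)            ∎)

  act-T⊠-φ : ∀ (A₁ A₂ : Alg M) →
    act (A₁ ⊗₀ A₂) ∘ T₁ (⊠ A₁ A₂) ∘ φ (Carrier A₁) (Carrier A₂) ≡ ⊠ A₁ A₂ ∘ (act A₁ ⁂ act A₂)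
  act-T⊠-φ A₁ A₂ = trans (sym assoc²)
    (trans (∘-congˡ (act-T⊠-ξ A₁ A₂)) (⊠-natural (act-hom M A₁) (act-hom M A₂)))

  module Pair (Q₁ Q₂ : CoalgObj M) where
    A₁ A₂ : Alg M
    A₁ = alg Q₁
    A₂ = alg Q₂

    X₁ X₂ : Obj
    X₁ = Carrier A₁
    X₂ = Carrier A₂

    B : Hom (X₁ × X₂) (T X₁ × T X₂)
    B = coalg Q₁ ⁂ coalg Q₂

    ηη : Hom (X₁ × X₂) (T X₁ × T X₂)
    ηη = η X₁ ⁂ η X₂

    ⊠₁₂ : Hom (X₁ × X₂) (Carrier (A₁ ⊗₀ A₂))
    ⊠₁₂ = ⊠ A₁ A₂

    ΨA : AlgHom M (A₁ ⊗₀ A₂) (F (X₁ × X₂))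
    ΨA = ξ X₁ X₂ ∘ₐ (coalg-hom M Q₁ ⊗₁ coalg-hom M Q₂)

    Ψ : Hom (Carrier (A₁ ⊗₀ A₂)) (T (X₁ × X₂))
    Ψ = hom ΨA

    tA : AlgHom M (A₁ ⊗₀ A₂) (F (Carrier (A₁ ⊗₀ A₂)))
    tA = free-hom M ⊠₁₂ ∘ₐ ΨA

    t : Hom (Carrier (A₁ ⊗₀ A₂)) (T (Carrier (A₁ ⊗₀ A₂)))
    t = tensorCoalg S 𝕋 Q₁ Q₂

    Ψ-⊠ : Ψ ∘ ⊠₁₂ ≡ φ X₁ X₂ ∘ B
    Ψ-⊠ = trans (pullʳ (⊠-natural (coalg-hom M Q₁) (coalg-hom M Q₂))) (sym assoc)

    coassoc-φB : T₁ B ∘ φ X₁ X₂ ∘ B ≡ T₁ ηη ∘ φ X₁ X₂ ∘ B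
    coassoc-φB = begin
      T₁ B ∘ φ _ _ ∘ B                                       ≡⟨ pullˡ (sym φ-natural) ⟩
      (φ _ _ ∘ (T₁ (coalg Q₁) ⁂ T₁ (coalg Q₂))) ∘ B           ≡⟨ pullʳ ⁂∘⁂ ⟩
      φ _ _ ∘ ((T₁ (coalg Q₁) ∘ coalg Q₁) ⁂ (T₁ (coalg Q₂) ∘ coalg Q₂))
        ≡⟨ ∘-congʳ (⁂-cong (sym (coassoc Q₁)) (sym (coassoc Q₂))) ⟩
      φ _ _ ∘ ((T₁ (η X₁) ∘ coalg Q₁) ⁂ (T₁ (η X₂) ∘ coalg Q₂)) ≡⟨ ∘-congʳ (sym ⁂∘⁂) ⟩
      φ _ _ ∘ (T₁ (η X₁) ⁂ T₁ (η X₂)) ∘ B                     ≡⟨ pullˡ φ-natural ⟩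
      (T₁ ηη ∘ φ _ _) ∘ B                                     ≡⟨ assoc ⟩
      T₁ ηη ∘ φ _ _ ∘ B                                       ∎

    -- Ψ forgets B: this is the identity through which all coalgebra laws below are verified
    collapse : ∀ {Z} (g : Hom (T X₁ × T X₂) Z) → T₁ (g ∘ B) ∘ Ψ ≡ T₁ (g ∘ ηη) ∘ Ψ
    collapse g = ⊠-unique (free-hom M (g ∘ B) ∘ₐ ΨA) (free-hom M (g ∘ ηη) ∘ₐ ΨA) (begin
      (T₁ (g ∘ B) ∘ Ψ) ∘ ⊠₁₂          ≡⟨ pullʳ Ψ-⊠ ⟩
      T₁ (g ∘ B) ∘ φ _ _ ∘ B          ≡⟨ trans (∘-congˡ T-∘) assoc ⟩
      T₁ g ∘ T₁ B ∘ φ _ _ ∘ B         ≡⟨ ∘-congʳ coassoc-φB ⟩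
      T₁ g ∘ T₁ ηη ∘ φ _ _ ∘ B        ≡⟨ pullˡ (sym T-∘) ⟩
      T₁ (g ∘ ηη) ∘ φ _ _ ∘ B         ≡⟨ sym (pullʳ Ψ-⊠) ⟩
      (T₁ (g ∘ ηη) ∘ Ψ) ∘ ⊠₁₂         ∎)

    T-along-t : ∀ {Z} (m : Hom (Carrier (A₁ ⊗₀ A₂)) Z) (g : Hom (T X₁ × T X₂) Z) →
                m ∘ ⊠₁₂ ≡ g ∘ B → T₁ m ∘ t ≡ T₁ (g ∘ ηη) ∘ Ψ
    T-along-t m g m-⊠ = begin
      T₁ m ∘ T₁ ⊠₁₂ ∘ Ψ   ≡⟨ pullˡ (sym T-∘) ⟩
      T₁ (m ∘ ⊠₁₂) ∘ Ψ    ≡⟨ ∘-congˡ (cong T₁ m-⊠) ⟩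
      T₁ (g ∘ B) ∘ Ψ      ≡⟨ collapse g ⟩
      T₁ (g ∘ ηη) ∘ Ψ     ∎

    -- counit law for t: checked on ⊠, where it reduces to aᵢ ∘ bᵢ = id
    t-counit : act (A₁ ⊗₀ A₂) ∘ t ≡ id
    t-counit = ⊠-unique (act-hom M (A₁ ⊗₀ A₂) ∘ₐ tA) (idᴬ M) (begin
      (act (A₁ ⊗₀ A₂) ∘ T₁ ⊠₁₂ ∘ Ψ) ∘ ⊠₁₂          ≡⟨ assoc² ⟩
      act (A₁ ⊗₀ A₂) ∘ T₁ ⊠₁₂ ∘ Ψ ∘ ⊠₁₂            ≡⟨ ∘-congʳ (∘-congʳ Ψ-⊠) ⟩
      act (A₁ ⊗₀ A₂) ∘ T₁ ⊠₁₂ ∘ φ X₁ X₂ ∘ B        ≡⟨ sym assoc² ⟩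
      (act (A₁ ⊗₀ A₂) ∘ T₁ ⊠₁₂ ∘ φ X₁ X₂) ∘ B      ≡⟨ ∘-congˡ (act-T⊠-φ A₁ A₂) ⟩
      (⊠₁₂ ∘ (act A₁ ⁂ act A₂)) ∘ B                ≡⟨ pullʳ ⁂∘⁂ ⟩
      ⊠₁₂ ∘ ((act A₁ ∘ coalg Q₁) ⁂ (act A₂ ∘ coalg Q₂))
        ≡⟨ ∘-congʳ (trans (⁂-cong (counit Q₁) (counit Q₂)) ⁂-id) ⟩
      ⊠₁₂ ∘ id                                      ≡⟨ trans identityʳ (sym identityˡ) ⟩
      id ∘ ⊠₁₂                                      ∎)

    t-⊠ : t ∘ ⊠₁₂ ≡ (T₁ ⊠₁₂ ∘ φ X₁ X₂) ∘ B
    t-⊠ = trans (pullʳ Ψ-⊠) (sym assoc)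

    -- coassociativity of t: collapse turns T(t) ∘ t into T(η ∘ ⊠) ∘ Ψ
    t-coassoc : T₁ (η _) ∘ t ≡ T₁ t ∘ t
    t-coassoc = sym (begin
      T₁ t ∘ t                                  ≡⟨ T-along-t t (T₁ ⊠₁₂ ∘ φ X₁ X₂) t-⊠ ⟩
      T₁ ((T₁ ⊠₁₂ ∘ φ X₁ X₂) ∘ ηη) ∘ Ψ          ≡⟨ ∘-congˡ (cong T₁ (trans (pullʳ φ-η) (η-natural ⊠₁₂))) ⟩
      T₁ (η _ ∘ ⊠₁₂) ∘ Ψ                        ≡⟨ trans (∘-congˡ T-∘) assoc ⟩
      T₁ (η _) ∘ t                              ∎)

    t-isCoalg : IsCoalg M (A₁ ⊗₀ A₂) t
    t-isCoalg = commutes tA , t-counit , t-coassoc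

    R : CoalgObj M
    R = tensorCoalgObj S 𝕋 Q₁ Q₂ t-isCoalg

    through : (A : Alg M) → Hom (X₁ × X₂) (Carrier A) → AlgHom M (A₁ ⊗₀ A₂) A
    through A k = act-hom M A ∘ₐ free-hom M k ∘ₐ ΨA

    through-⊠ : ∀ (A : Alg M) (k : Hom (X₁ × X₂) (Carrier A)) →
                hom (through A k) ∘ ⊠₁₂ ≡ (act A ∘ T₁ k ∘ φ X₁ X₂) ∘ B
    through-⊠ A k = trans assoc² (trans (∘-congʳ (∘-congʳ Ψ-⊠)) (sym assoc²))

    through-η : ∀ (A : Alg M) (k : Hom (X₁ × X₂) (Carrier A)) → (act A ∘ T₁ k ∘ φ X₁ X₂) ∘ ηη ≡ k
    through-η A k = begin
      (act A ∘ T₁ k ∘ φ X₁ X₂) ∘ ηη    ≡⟨ assoc² ⟩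
      act A ∘ T₁ k ∘ φ X₁ X₂ ∘ ηη      ≡⟨ ∘-congʳ (∘-congʳ φ-η) ⟩
      act A ∘ T₁ k ∘ η _               ≡⟨ ∘-congʳ (η-natural k) ⟩
      act A ∘ η _ ∘ k                  ≡⟨ pullˡ (act-η A) ⟩
      id ∘ k                           ≡⟨ identityˡ ⟩
      k                                ∎

    T-through : ∀ (A : Alg M) (k : Hom (X₁ × X₂) (Carrier A)) →
                T₁ (hom (through A k)) ∘ t ≡ T₁ k ∘ Ψ
    T-through A k = trans (T-along-t _ _ (through-⊠ A k)) (∘-congˡ (cong T₁ (through-η A k)))

    through-coalg : ∀ (Q : CoalgObj M) (k : Hom (X₁ × X₂) (Carrier (alg Q)))
                      (h : Hom (T X₁ × T X₂) (T (Carrier (alg Q)))) →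
                    h ∘ B ≡ coalg Q ∘ k → h ∘ ηη ≡ η _ ∘ k →
                    coalg Q ∘ hom (through (alg Q) k) ≡ T₁ (hom (through (alg Q) k)) ∘ t
    through-coalg Q k h h-B h-η = begin
      coalg Q ∘ act (alg Q) ∘ T₁ k ∘ Ψ    ≡⟨ pullˡ (proj₁ (isCoalg Q)) ⟩
      (μ _ ∘ T₁ (coalg Q)) ∘ T₁ k ∘ Ψ     ≡⟨ pullʳ (pullˡ (sym T-∘)) ⟩
      μ _ ∘ T₁ (coalg Q ∘ k) ∘ Ψ          ≡⟨ ∘-congʳ (∘-congˡ (cong T₁ (sym h-B))) ⟩
      μ _ ∘ T₁ (h ∘ B) ∘ Ψ                ≡⟨ ∘-congʳ (collapse h) ⟩
      μ _ ∘ T₁ (h ∘ ηη) ∘ Ψ               ≡⟨ ∘-congʳ (∘-congˡ (cong T₁ h-η)) ⟩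
      μ _ ∘ T₁ (η _ ∘ k) ∘ Ψ              ≡⟨ pullˡ (μ∘Tη k) ⟩
      T₁ k ∘ Ψ                            ≡⟨ sym (T-through (alg Q) k) ⟩
      T₁ (hom (through (alg Q) k)) ∘ t    ∎

    p₁ : CoalgHom M R Q₁
    p₁ = hom (through A₁ π₁) , commutes (through A₁ π₁) , through-coalg Q₁ π₁ π₁ π₁∘⟨⟩ π₁∘⟨⟩

    p₂ : CoalgHom M R Q₂
    p₂ = hom (through A₂ π₂) , commutes (through A₂ π₂) , through-coalg Q₂ π₂ π₂ π₂∘⟨⟩ π₂∘⟨⟩

    Ψ-via-projections : T₁ ⟨ proj₁ p₁ , proj₁ p₂ ⟩ ∘ t ≡ Ψ
    Ψ-via-projections = begin
      T₁ ⟨ proj₁ p₁ , proj₁ p₂ ⟩ ∘ t    ≡⟨ T-along-t _ ⟨ G A₁ π₁ , G A₂ π₂ ⟩ pair-⊠ ⟩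
      T₁ (⟨ G A₁ π₁ , G A₂ π₂ ⟩ ∘ ηη) ∘ Ψ
        ≡⟨ ∘-congˡ (cong T₁ (trans ⟨⟩∘ (trans (cong₂ ⟨_,_⟩ (through-η A₁ π₁) (through-η A₂ π₂)) ⟨π₁,π₂⟩))) ⟩
      T₁ id ∘ Ψ                         ≡⟨ trans (∘-congˡ T-id) identityˡ ⟩
      Ψ                                 ∎
      where
      G : (A : Alg M) → Hom (X₁ × X₂) (Carrier A) → Hom (T X₁ × T X₂) (Carrier A)
      G A k = act A ∘ T₁ k ∘ φ X₁ X₂
      pair-⊠ : ⟨ proj₁ p₁ , proj₁ p₂ ⟩ ∘ ⊠₁₂ ≡ ⟨ G A₁ π₁ , G A₂ π₂ ⟩ ∘ B
      pair-⊠ = trans ⟨⟩∘ (trans (cong₂ ⟨_,_⟩ (through-⊠ A₁ π₁) (through-⊠ A₂ π₂)) (sym ⟨⟩∘))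

    determined : ∀ (Q : CoalgObj M) (g : Hom (Carrier (alg Q)) (Carrier (A₁ ⊗₀ A₂))) →
                 t ∘ g ≡ T₁ g ∘ coalg Q →
                 g ≡ act (A₁ ⊗₀ A₂) ∘ T₁ ⊠₁₂ ∘ T₁ ⟨ proj₁ p₁ ∘ g , proj₁ p₂ ∘ g ⟩ ∘ coalg Q
    determined Q g g-coalg = begin
      g
        ≡⟨ sym (trans (∘-congˡ t-counit) identityˡ) ⟩
      (act (A₁ ⊗₀ A₂) ∘ T₁ ⊠₁₂ ∘ Ψ) ∘ g
        ≡⟨ trans assoc² (∘-congʳ (∘-congʳ (∘-congˡ (sym Ψ-via-projections)))) ⟩
      act (A₁ ⊗₀ A₂) ∘ T₁ ⊠₁₂ ∘ (T₁ ⟨ proj₁ p₁ , proj₁ p₂ ⟩ ∘ t) ∘ g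
        ≡⟨ ∘-congʳ (∘-congʳ (pullʳ g-coalg)) ⟩
      act (A₁ ⊗₀ A₂) ∘ T₁ ⊠₁₂ ∘ T₁ ⟨ proj₁ p₁ , proj₁ p₂ ⟩ ∘ T₁ g ∘ coalg Q
        ≡⟨ ∘-congʳ (∘-congʳ (pullˡ (trans (sym T-∘) (cong T₁ ⟨⟩∘)))) ⟩
      act (A₁ ⊗₀ A₂) ∘ T₁ ⊠₁₂ ∘ T₁ ⟨ proj₁ p₁ ∘ g , proj₁ p₂ ∘ g ⟩ ∘ coalg Q ∎

    -- Ψ ∘ (a₁ ⊗ a₂) ∘ ξ⁻¹ = μ ∘ T(φ ∘ B), both being algebra maps out of F(X₁ × X₂)
    Ψ-after-actions : Ψ ∘ hom (act-hom M A₁ ⊗₁ act-hom M A₂) ∘ hom (ξ⁻¹ X₁ X₂) ≡ μ _ ∘ T₁ (φ X₁ X₂ ∘ B)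
    Ψ-after-actions =
      free-ext (ΨA ∘ₐ (act-hom M A₁ ⊗₁ act-hom M A₂) ∘ₐ ξ⁻¹ X₁ X₂)
               (act-hom M (F (X₁ × X₂)) ∘ₐ free-hom M (φ X₁ X₂ ∘ B)) (begin
        (Ψ ∘ aa ∘ hom (ξ⁻¹ X₁ X₂)) ∘ η _    ≡⟨ assoc² ⟩
        Ψ ∘ aa ∘ hom (ξ⁻¹ X₁ X₂) ∘ η _      ≡⟨ ∘-congʳ (∘-congʳ ξ⁻¹-η) ⟩
        Ψ ∘ aa ∘ ⊠ _ _ ∘ ηη                 ≡⟨ ∘-congʳ (actions-on-units A₁ A₂) ⟩
        Ψ ∘ ⊠₁₂                             ≡⟨ Ψ-⊠ ⟩
        φ X₁ X₂ ∘ B                         ≡⟨ sym (trans (pullˡ μ-η-left) identityˡ) ⟩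
        μ _ ∘ η _ ∘ φ X₁ X₂ ∘ B             ≡⟨ ∘-congʳ (sym (η-natural _)) ⟩
        μ _ ∘ T₁ (φ X₁ X₂ ∘ B) ∘ η _        ≡⟨ sym assoc ⟩
        (μ _ ∘ T₁ (φ X₁ X₂ ∘ B)) ∘ η _      ∎)
      where
      aa : Hom (Carrier (F X₁ ⊗₀ F X₂)) (Carrier (A₁ ⊗₀ A₂))
      aa = hom (act-hom M A₁ ⊗₁ act-hom M A₂)

  module TensorOfMorphisms (Q Q' Q₁ Q₂ : CoalgObj M) (f : CoalgHom M Q Q₁) (g : CoalgHom M Q' Q₂) where
    f⊗g : AlgHom M (alg Q ⊗₀ alg Q') (alg Q₁ ⊗₀ alg Q₂)
    f⊗g = algHom {Q} {Q₁} f ⊗₁ algHom {Q'} {Q₂} g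

    Ψ-natural : Pair.Ψ Q₁ Q₂ ∘ hom f⊗g ≡ T₁ (proj₁ f ⁂ proj₁ g) ∘ Pair.Ψ Q Q'
    Ψ-natural = ⊠-unique (Pair.ΨA Q₁ Q₂ ∘ₐ f⊗g) (free-hom M (proj₁ f ⁂ proj₁ g) ∘ₐ Pair.ΨA Q Q') (begin
      (Pair.Ψ Q₁ Q₂ ∘ hom f⊗g) ∘ ⊠ _ _
        ≡⟨ pullʳ (⊠-natural (algHom {Q} {Q₁} f) (algHom {Q'} {Q₂} g)) ⟩
      Pair.Ψ Q₁ Q₂ ∘ ⊠ _ _ ∘ (proj₁ f ⁂ proj₁ g)        ≡⟨ pullˡ (Pair.Ψ-⊠ Q₁ Q₂) ⟩
      (φ _ _ ∘ (coalg Q₁ ⁂ coalg Q₂)) ∘ (proj₁ f ⁂ proj₁ g) ≡⟨ pullʳ ⁂∘⁂ ⟩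
      φ _ _ ∘ ((coalg Q₁ ∘ proj₁ f) ⁂ (coalg Q₂ ∘ proj₁ g))
        ≡⟨ ∘-congʳ (⁂-cong (proj₂ (proj₂ f)) (proj₂ (proj₂ g))) ⟩
      φ _ _ ∘ ((T₁ (proj₁ f) ∘ coalg Q) ⁂ (T₁ (proj₁ g) ∘ coalg Q')) ≡⟨ ∘-congʳ (sym ⁂∘⁂) ⟩
      φ _ _ ∘ (T₁ (proj₁ f) ⁂ T₁ (proj₁ g)) ∘ (coalg Q ⁂ coalg Q') ≡⟨ pullˡ φ-natural ⟩
      (T₁ (proj₁ f ⁂ proj₁ g) ∘ φ _ _) ∘ (coalg Q ⁂ coalg Q')     ≡⟨ pullʳ (sym (Pair.Ψ-⊠ Q Q')) ⟩
      T₁ (proj₁ f ⁂ proj₁ g) ∘ Pair.Ψ Q Q' ∘ ⊠ _ _              ≡⟨ sym assoc ⟩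
      (T₁ (proj₁ f ⁂ proj₁ g) ∘ Pair.Ψ Q Q') ∘ ⊠ _ _            ∎)

    tensor-mor : CoalgHom M (Pair.R Q Q') (Pair.R Q₁ Q₂)
    tensor-mor = hom f⊗g , commutes f⊗g , coalg-law
      where
      coalg-law : Pair.t Q₁ Q₂ ∘ hom f⊗g ≡ T₁ (hom f⊗g) ∘ Pair.t Q Q'
      coalg-law = begin
        (T₁ (⊠ _ _) ∘ Pair.Ψ Q₁ Q₂) ∘ hom f⊗g          ≡⟨ pullʳ Ψ-natural ⟩
        T₁ (⊠ _ _) ∘ T₁ (proj₁ f ⁂ proj₁ g) ∘ Pair.Ψ Q Q'
          ≡⟨ pullˡ (trans (sym T-∘) (cong T₁ (sym (⊠-natural (algHom {Q} {Q₁} f) (algHom {Q'} {Q₂} g))))) ⟩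
        T₁ (hom f⊗g ∘ ⊠ _ _) ∘ Pair.Ψ Q Q'             ≡⟨ trans (∘-congˡ T-∘) assoc ⟩
        T₁ (hom f⊗g) ∘ Pair.t Q Q'                     ∎

  module Diagonal (Q : CoalgObj M) where
    open Pair Q Q

    X : Obj
    X = Carrier (alg Q)

    aa : AlgHom M (F X ⊗₀ F X) (alg Q ⊗₀ alg Q)
    aa = act-hom M (alg Q) ⊗₁ act-hom M (alg Q)

    kA : AlgHom M (F X) (alg Q ⊗₀ alg Q)
    kA = aa ∘ₐ ξ⁻¹ X X ∘ₐ free-hom M Δ

    dA : AlgHom M (alg Q) (alg Q ⊗₀ alg Q)
    dA = aa ∘ₐ ξ⁻¹ X X ∘ₐ free-hom M Δ ∘ₐ coalg-hom M Q

    k-η : hom kA ∘ η X ≡ ⊠₁₂ ∘ Δ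
    k-η = begin
      (hom aa ∘ hom (ξ⁻¹ X X) ∘ T₁ Δ) ∘ η X     ≡⟨ assoc² ⟩
      hom aa ∘ hom (ξ⁻¹ X X) ∘ T₁ Δ ∘ η X       ≡⟨ ∘-congʳ (∘-congʳ (η-natural Δ)) ⟩
      hom aa ∘ hom (ξ⁻¹ X X) ∘ η (X × X) ∘ Δ    ≡⟨ ∘-congʳ (trans (pullˡ ξ⁻¹-η) assoc) ⟩
      hom aa ∘ ⊠ _ _ ∘ (η X ⁂ η X) ∘ Δ          ≡⟨ sym assoc² ⟩
      (hom aa ∘ ⊠ _ _ ∘ (η X ⁂ η X)) ∘ Δ        ≡⟨ ∘-congˡ (actions-on-units (alg Q) (alg Q)) ⟩
      ⊠₁₂ ∘ Δ                                   ∎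

    Ψ∘d : Ψ ∘ hom dA ≡ T₁ Δ ∘ coalg Q
    Ψ∘d = begin
      Ψ ∘ hom dA                                   ≡⟨ sym assoc² ⟩
      (Ψ ∘ hom aa ∘ hom (ξ⁻¹ X X)) ∘ T₁ Δ ∘ coalg Q ≡⟨ ∘-congˡ Ψ-after-actions ⟩
      (μ _ ∘ T₁ (φ X X ∘ B)) ∘ T₁ Δ ∘ coalg Q      ≡⟨ pullʳ (pullˡ (sym T-∘)) ⟩
      μ _ ∘ T₁ ((φ X X ∘ B) ∘ Δ) ∘ coalg Q
        ≡⟨ ∘-congʳ (∘-congˡ (cong T₁ (trans (pullʳ (sym Δ-natural)) (sym assoc)))) ⟩
      μ _ ∘ T₁ ((φ X X ∘ Δ) ∘ coalg Q) ∘ coalg Q   ≡⟨ ∘-congʳ (absorb Q (φ X X ∘ Δ)) ⟩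
      μ _ ∘ T₁ ((φ X X ∘ Δ) ∘ η X) ∘ coalg Q
        ≡⟨ ∘-congʳ (∘-congˡ (cong T₁ (trans (pullʳ Δ-natural) (pullˡ φ-η)))) ⟩
      μ _ ∘ T₁ (η _ ∘ Δ) ∘ coalg Q                 ≡⟨ pullˡ (μ∘Tη Δ) ⟩
      T₁ Δ ∘ coalg Q                               ∎

    -- d_b is a coalgebra map: both sides equal T(⊠ ∘ Δ) ∘ b
    d-coalg : t ∘ hom dA ≡ T₁ (hom dA) ∘ coalg Q
    d-coalg = begin
      (T₁ ⊠₁₂ ∘ Ψ) ∘ hom dA                ≡⟨ pullʳ Ψ∘d ⟩
      T₁ ⊠₁₂ ∘ T₁ Δ ∘ coalg Q              ≡⟨ pullˡ (sym T-∘) ⟩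
      T₁ (⊠₁₂ ∘ Δ) ∘ coalg Q               ≡⟨ ∘-congˡ (cong T₁ (sym k-η)) ⟩
      T₁ (hom kA ∘ η X) ∘ coalg Q          ≡⟨ sym (absorb Q (hom kA)) ⟩
      T₁ (hom kA ∘ coalg Q) ∘ coalg Q      ≡⟨ ∘-congˡ (cong T₁ assoc²) ⟩
      T₁ (hom dA) ∘ coalg Q                ∎

    diagonal-mor : CoalgHom M Q R
    diagonal-mor = hom dA , commutes dA , d-coalg

  module Product (Q₁ Q₂ : CoalgObj M) where
    open Pair Q₁ Q₂

    universal : IsProductᶜ M R Q₁ Q₂ p₁ p₂
    universal Q q₁ q₂ = h , component Q₁ π₁ q₁ π₁∘⟨⟩ , component Q₂ π₂ q₂ π₂∘⟨⟩ , unique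
      where
      h : CoalgHom M Q R
      h = compose Q (Pair.R Q Q) R (TensorOfMorphisms.tensor-mor Q Q Q₁ Q₂ q₁ q₂) (Diagonal.diagonal-mor Q)

      Ψ∘h : Ψ ∘ proj₁ h ≡ T₁ ⟨ proj₁ q₁ , proj₁ q₂ ⟩ ∘ coalg Q
      Ψ∘h = begin
        Ψ ∘ proj₁ h
          ≡⟨ pullˡ (TensorOfMorphisms.Ψ-natural Q Q Q₁ Q₂ q₁ q₂) ⟩
        (T₁ (proj₁ q₁ ⁂ proj₁ q₂) ∘ Pair.Ψ Q Q) ∘ proj₁ (Diagonal.diagonal-mor Q)
          ≡⟨ pullʳ (Diagonal.Ψ∘d Q) ⟩
        T₁ (proj₁ q₁ ⁂ proj₁ q₂) ∘ T₁ Δ ∘ coalg Q         ≡⟨ pullˡ (trans (sym T-∘) (cong T₁ ⁂∘Δ)) ⟩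
        T₁ ⟨ proj₁ q₁ , proj₁ q₂ ⟩ ∘ coalg Q               ∎

      component : ∀ (Qᵢ : CoalgObj M) (k : Hom (X₁ × X₂) (Carrier (alg Qᵢ))) (q : CoalgHom M Q Qᵢ) →
                  k ∘ ⟨ proj₁ q₁ , proj₁ q₂ ⟩ ≡ proj₁ q → hom (through (alg Qᵢ) k) ∘ proj₁ h ≡ proj₁ q
      component Qᵢ k q k-q = begin
        (act (alg Qᵢ) ∘ T₁ k ∘ Ψ) ∘ proj₁ h                    ≡⟨ trans assoc² (∘-congʳ (∘-congʳ Ψ∘h)) ⟩
        act (alg Qᵢ) ∘ T₁ k ∘ T₁ ⟨ proj₁ q₁ , proj₁ q₂ ⟩ ∘ coalg Q
          ≡⟨ ∘-congʳ (pullˡ (trans (sym T-∘) (cong T₁ k-q))) ⟩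
        act (alg Qᵢ) ∘ T₁ (proj₁ q) ∘ coalg Q                 ≡⟨ retract {Q} {Qᵢ} q ⟩
        proj₁ q                                                ∎

      unique : (h' : CoalgHom M Q R) → proj₁ p₁ ∘ proj₁ h' ≡ proj₁ q₁ →
               proj₁ p₂ ∘ proj₁ h' ≡ proj₁ q₂ → proj₁ h' ≡ proj₁ h
      unique h' h'₁ h'₂ = begin
        proj₁ h'                       ≡⟨ determined Q (proj₁ h') (proj₂ (proj₂ h')) ⟩
        act (A₁ ⊗₀ A₂) ∘ T₁ ⊠₁₂ ∘ T₁ ⟨ proj₁ p₁ ∘ proj₁ h' , proj₁ p₂ ∘ proj₁ h' ⟩ ∘ coalg Q
          ≡⟨ cong (λ z → act (A₁ ⊗₀ A₂) ∘ T₁ ⊠₁₂ ∘ T₁ z ∘ coalg Q)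
                  (cong₂ ⟨_,_⟩ (trans h'₁ (sym (component Q₁ π₁ q₁ π₁∘⟨⟩)))
                               (trans h'₂ (sym (component Q₂ π₂ q₂ π₂∘⟨⟩)))) ⟩
        act (A₁ ⊗₀ A₂) ∘ T₁ ⊠₁₂ ∘ T₁ ⟨ proj₁ p₁ ∘ proj₁ h , proj₁ p₂ ∘ proj₁ h ⟩ ∘ coalg Q
          ≡⟨ sym (determined Q (proj₁ h) (proj₂ (proj₂ h))) ⟩
        proj₁ h                        ∎

  module FreeProduct (X Y : Obj) where
    open Pair (FreeCoalg M X) (FreeCoalg M Y)

    Ψ-free : Ψ ≡ T₁ (η X ⁂ η Y) ∘ hom (ξ X Y)
    Ψ-free = sym (ξ-natural (η X) (η Y))

    t-free : t ≡ T₁ (⊠ (F X) (F Y) ∘ (η X ⁂ η Y)) ∘ hom (ξ X Y)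
    t-free = trans (∘-congʳ Ψ-free) (pullˡ (sym T-∘))

    ξ-mor : CoalgHom M R (FreeCoalg M (X × Y))
    ξ-mor = hom (ξ X Y) , commutes (ξ X Y) , sym (begin
      T₁ (hom (ξ X Y)) ∘ t                                        ≡⟨ ∘-congʳ t-free ⟩
      T₁ (hom (ξ X Y)) ∘ T₁ (⊠ _ _ ∘ (η X ⁂ η Y)) ∘ hom (ξ X Y)   ≡⟨ pullˡ (sym T-∘) ⟩
      T₁ (hom (ξ X Y) ∘ ⊠ _ _ ∘ (η X ⁂ η Y)) ∘ hom (ξ X Y)        ≡⟨ ∘-congˡ (cong T₁ ξ-⊠) ⟩
      T₁ (η (X × Y)) ∘ hom (ξ X Y)                                ∎)

    ξ⁻¹-mor : CoalgHom M (FreeCoalg M (X × Y)) R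
    ξ⁻¹-mor = hom (ξ⁻¹ X Y) , commutes (ξ⁻¹ X Y) , (begin
      t ∘ hom (ξ⁻¹ X Y)                                           ≡⟨ ∘-congˡ t-free ⟩
      (T₁ (⊠ _ _ ∘ (η X ⁂ η Y)) ∘ hom (ξ X Y)) ∘ hom (ξ⁻¹ X Y)    ≡⟨ pullʳ ξ-iso₂ ⟩
      T₁ (⊠ _ _ ∘ (η X ⁂ η Y)) ∘ id                               ≡⟨ identityʳ ⟩
      T₁ (⊠ _ _ ∘ (η X ⁂ η Y))                                    ≡⟨ cong T₁ (sym ξ⁻¹-η) ⟩
      T₁ (hom (ξ⁻¹ X Y) ∘ η (X × Y))                              ≡⟨ T-∘ ⟩
      T₁ (hom (ξ⁻¹ X Y)) ∘ T₁ (η (X × Y))                         ∎)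

    restrict-free : ∀ {Z} (k : Hom (T X × T Y) (T Z)) (k₀ : Hom (X × Y) Z) →
                    k ∘ (η X ⁂ η Y) ≡ η Z ∘ k₀ → μ Z ∘ T₁ k ∘ Ψ ≡ T₁ k₀ ∘ hom (ξ X Y)
    restrict-free k k₀ k-η = begin
      μ _ ∘ T₁ k ∘ Ψ                               ≡⟨ ∘-congʳ (∘-congʳ Ψ-free) ⟩
      μ _ ∘ T₁ k ∘ T₁ (η X ⁂ η Y) ∘ hom (ξ X Y)    ≡⟨ ∘-congʳ (pullˡ (trans (sym T-∘) (cong T₁ k-η))) ⟩
      μ _ ∘ T₁ (η _ ∘ k₀) ∘ hom (ξ X Y)            ≡⟨ pullˡ (μ∘Tη k₀) ⟩
      T₁ k₀ ∘ hom (ξ X Y)                          ∎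

    preserves : IsProductᶜ M (FreeCoalg M (X × Y)) (FreeCoalg M X) (FreeCoalg M Y)
                  (FreeCoalg₁ M π₁) (FreeCoalg₁ M π₂)
    preserves = transport-product {R = R} {FreeCoalg M (X × Y)} {FreeCoalg M X} {FreeCoalg M Y}
      {p₁} {p₂} {FreeCoalg₁ M π₁} {FreeCoalg₁ M π₂} ξ-mor ξ⁻¹-mor ξ-iso₂
      (sym (restrict-free π₁ π₁ π₁∘⟨⟩)) (sym (restrict-free π₂ π₂ π₂∘⟨⟩))
      (Product.universal (FreeCoalg M X) (FreeCoalg M Y))

proposition6p6 :
  ∀ {o ℓ : Level} {𝒜 : Category o ℓ} {P : FiniteProducts 𝒜} {M : Monad 𝒜}
    (S : CommutativeStrength P M) (𝕋 : AlgTensor S) →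
  let open Category 𝒜
      open FiniteProducts P
      open Monad M
      open AlgTensor 𝕋
  in
  -- u_b and d_b are homomorphisms of T̄-coalgebras
  (∀ (Q : CoalgObj M) →
      IsCoalgMor M (alg Q) (coalg Q) (Free M 𝟙) (T₁ (η 𝟙)) (u S 𝕋 Q)
      ∧ IsCoalgMor M (alg Q) (coalg Q) (alg Q ⊗₀ alg Q) (tensorCoalg S 𝕋 Q Q) (d S 𝕋 Q))
  -- CoAlg(T̄) has a terminal object: T(η₁) on T(1)
  ∧ IsTerminalᶜ M (FreeCoalg M 𝟙)
  -- binary products in CoAlg(T̄): the tensor coalgebra on X₁ ⊗ X₂
  ∧ (∀ (Q₁ Q₂ : CoalgObj M) →
      Σ (IsCoalg M (alg Q₁ ⊗₀ alg Q₂) (tensorCoalg S 𝕋 Q₁ Q₂)) λ c →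
      Σ[ p₁ ∈ CoalgHom M (tensorCoalgObj S 𝕋 Q₁ Q₂ c) Q₁ ]
      Σ[ p₂ ∈ CoalgHom M (tensorCoalgObj S 𝕋 Q₁ Q₂ c) Q₂ ]
        IsProductᶜ M (tensorCoalgObj S 𝕋 Q₁ Q₂ c) Q₁ Q₂ p₁ p₂)
  -- X ↦ (μ_X, T(η_X)) preserves finite products
  ∧ IsTerminalᶜ M (FreeCoalg M 𝟙)
  ∧ (∀ (X Y : Obj) →
      IsProductᶜ M (FreeCoalg M (X × Y)) (FreeCoalg M X) (FreeCoalg M Y)
        (FreeCoalg₁ M π₁) (FreeCoalg₁ M π₂))
proposition6p6 {P = P} {M} S 𝕋 =
    (λ Q → proj₂ (discard Q) , proj₂ (Diagonal.diagonal-mor Q))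
  , free-terminal
  , (λ Q₁ Q₂ → Pair.t-isCoalg Q₁ Q₂ , Pair.p₁ Q₁ Q₂ , Pair.p₂ Q₁ Q₂ , Product.universal Q₁ Q₂)
  , free-terminal
  , FreeProduct.preserves
  where
  open CoalgebraLemmas {P = P} M
  open TensorCoalgebras S 𝕋
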